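{- Let $d:\mathbb{Z}_{\ge 0}\to\mathbb{Z}_{\ge 0}$ be defined by $d(n)=\sum_{k=0}^{n}\operatorname{bit}_k(n-k)\,2^k$. Then: (i) For $n>0$, with $m=\lfloor \log_2 n\rfloor$, $$ d(n)=2^m-\tfrac12-\tfrac12\sum_{k=0}^{m}(-1)^{\lfloor (n-k)/2^k\rfloor}\,2^k. $$ (ii) $d(0)=0$, $d(1)=1$, and for all integers $i\ge 1$ and $-1\le j\le 2^i-1$, $$ d(2^i+i+j)=\begin{cases} d(i-1) & \text{if } j=-1,\\ 2^i+d(i+j) & \text{if } 0\le j\le 2^i-1.\end{cases} $$ (iii) For $n\ge 1$, $$ d(n)= n-\sum_{1\le k\le \log_2 n,\; n\equiv k-1 \pmod{2^k}} 2^k. $$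
   Context: For integers $m\ge 0$ and $k\ge 0$, let $\operatorname{bit}_k(m)=\lfloor m/2^k\rfloor \bmod 2$ be the coefficient of $2^k$ in the binary expansion of $m$. The function $d$ is the "downward-sloping" reading of the right-justified list of binary expansions of $0,1,2,\dots$: the $2^k$ digit of $d(n)$ is the $2^k$ digit of $n-k$ (taken as $0$ when $k>n$). Its first values are $0,1,0,3,2,1,4,7,6,5,0,11,\dots$. -}

module Defs where

open import Data.Nat using (ℕ; zero; suc; _+_; _*_; _∸_; _^_; _<?_; _≟_)
open import Data.Nat.DivMod using (_/_; _%_)
open import Data.Nat.Properties using (m^n≢0)
open import Data.Bool using (if_then_else_)
open import Relation.Nullary.Decidable using (does)
import Data.Rational as ℚ
open ℚ using (ℚ)
import Data.Integer as ℤ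

div2^ : ℕ → ℕ → ℕ
div2^ m k = _/_ m (2 ^ k) {{m^n≢0 2 k}}

mod2^ : ℕ → ℕ → ℕ
mod2^ m k = _%_ m (2 ^ k) {{m^n≢0 2 k}}

bit : ℕ → ℕ → ℕ
bit k m = div2^ m k % 2

sumTo : ℕ → (ℕ → ℕ) → ℕ
sumTo zero    f = f 0
sumTo (suc n) f = sumTo n f + f (suc n)

sumToℚ : ℕ → (ℕ → ℚ) → ℚ
sumToℚ zero    f = f 0
sumToℚ (suc n) f = sumToℚ n f ℚ.+ f (suc n)

d : ℕ → ℕ
d n = sumTo n (λ k → bit k (n ∸ k) * 2 ^ k)

ℕ→ℚ : ℕ → ℚ
ℕ→ℚ n = ℤ.+ n ℚ./ 1

powℚ : ℚ → ℕ → ℚ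
powℚ q zero    = ℚ.1ℚ
powℚ q (suc e) = q ℚ.* powℚ q e

condSum : ℕ → ℕ → ℕ
condSum n zero    = 0
condSum n (suc k) =
  condSum n k + (if does (mod2^ n (suc k) ≟ mod2^ (suc k ∸ 1) (suc k)) then 2 ^ suc k else 0)

{-# OPTIONS --safe #-}
-- Let h(k) = 2^(k+1) ⌊(n − k)/2^(k+1)⌋ (highPart n k), so that h(−1) = n and h(⌊log₂ n⌋) = 0. Splitting off
-- the lowest bit gives 2^k ⌊(n − k)/2^k⌋ = bit_k(n − k) 2^k + h(k), and lowering the numerator
-- from n − k + 1 to n − k drops 2^k ⌊·/2^k⌋ by 2^k exactly when n ≡ k − 1 (mod 2^k). Hence
-- h(k − 1) = bit_k(n − k) 2^k + [n ≡ k − 1 (mod 2^k)] 2^k + h(k), which telescopes to (iii).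
-- (i) is the digit sum d(n) = Σ_{k ≤ ⌊log₂ n⌋} bit_k(n − k) 2^k rewritten with
-- (−1)^q = 1 − 2 (q mod 2), and (ii) holds because adding 2^i to n − k leaves its bits below i
-- unchanged, while the terms with n − k < 2^k vanish.
module Submission where

open import Defs
open import Data.Nat using (ℕ; zero; suc; _+_; _*_; _∸_; _^_; _≤_; _<_; z≤n; s≤s; NonZero)
open import Data.Nat.Properties
open import Data.Nat.DivMod
open import Data.Nat.Divisibility using (_∣_; _∣?_; divides; n∣m*n; m∣m*n; n∣m⇒m%n≡0)
open import Data.Nat.Logarithm using (⌊log₂_⌋; ⌊log₂⌋-mono-≤; ⌊log₂[2^n]⌋≡n)
open import Data.Nat.Solver using (module +-*-Solver)
open import Algebra.Properties.CommutativeSemigroup +-commutativeSemigroup using (x∙yz≈y∙xz)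
open import Data.Bool using (if_then_else_)
open import Data.Product using (_×_; _,_)
open import Data.Sum using (inj₁; inj₂)
open import Function using (_∘_; _⇔_; mk⇔)
open import Relation.Nullary using (¬_; does; yes; no; contradiction)
open import Relation.Nullary.Decidable using (dec-true; dec-false; does-⇔)
open import Relation.Binary.PropositionalEquality
import Data.Integer as ℤ
import Data.Integer.Properties as ℤP
import Data.Rational as ℚ
import Data.Rational.Properties as ℚP
import Data.Rational.Solver as ℚSolver
import Data.Rational.Unnormalised as ℚᵘ
import Data.Rational.Unnormalised.Properties as ℚᵘP
open ≡-Reasoning

sumTo-cong : ∀ {f g : ℕ → ℕ} n → (∀ {k} → k ≤ n → f k ≡ g k) → sumTo n f ≡ sumTo n g
sumTo-cong zero    f≗g = f≗g z≤n
sumTo-cong (suc n) f≗g = cong₂ _+_ (sumTo-cong n (f≗g ∘ m≤n⇒m≤1+n)) (f≗g ≤-refl)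

sumTo-truncate : ∀ (f : ℕ → ℕ) {m n} → m ≤ n → (∀ {k} → m < k → f k ≡ 0) → sumTo n f ≡ sumTo m f
sumTo-truncate f {n = zero}  z≤n   _ = refl
sumTo-truncate f {m} {suc n} m≤1+n f≡0 with m≤n⇒m<n∨m≡n m≤1+n
... | inj₂ refl      = refl
... | inj₁ (s≤s m≤n) = begin
  sumTo n f + f (suc n) ≡⟨ cong₂ _+_ (sumTo-truncate f m≤n f≡0) (f≡0 (s≤s m≤n)) ⟩
  sumTo m f + 0         ≡⟨ +-identityʳ _ ⟩
  sumTo m f             ∎

[m+k*n]/n≡m/n+k : ∀ m k n .{{_ : NonZero n}} → (m + k * n) / n ≡ m / n + k
[m+k*n]/n≡m/n+k m k n = trans (+-distrib-/-∣ʳ m (n∣m*n k)) (cong (m / n +_) (m*n/n≡m k n))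

*-/-suc : ∀ m n .{{_ : NonZero n}} →
          n * (suc m / n) ≡ n * (m / n) + (if does (n ∣? suc m) then n else 0)
*-/-suc m n with m≤n⇒m<n∨m≡n (m%n<n m n)
... | inj₁ 1+r<n = begin
  n * (suc m / n)           ≡⟨ cong (n *_) (/-congˡ 1+m≡1+r+q*n) ⟩
  n * ((suc r + q * n) / n) ≡⟨ cong (n *_) ([m+k*n]/n≡m/n+k (suc r) q n) ⟩
  n * (suc r / n + q)       ≡⟨ cong (λ x → n * (x + q)) (m<n⇒m/n≡0 1+r<n) ⟩
  n * q                     ≡⟨ +-identityʳ (n * q) ⟨
  n * q + 0                 ≡⟨ cong (λ b → n * q + (if b then n else 0)) (dec-false (n ∣? suc m) n∤1+m) ⟨
  n * q + (if does (n ∣? suc m) then n else 0) ∎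
  where
  r = m % n
  q = m / n
  1+m≡1+r+q*n : suc m ≡ suc r + q * n
  1+m≡1+r+q*n = cong suc (m≡m%n+[m/n]*n m n)
  n∤1+m : ¬ n ∣ suc m
  n∤1+m n∣1+m = 0≢1+n (begin
    0                     ≡⟨ n∣m⇒m%n≡0 (suc m) n n∣1+m ⟨
    suc m % n             ≡⟨ %-congˡ 1+m≡1+r+q*n ⟩
    (suc r + q * n) % n   ≡⟨ [m+kn]%n≡m%n (suc r) q n ⟩
    suc r % n             ≡⟨ m<n⇒m%n≡m 1+r<n ⟩
    suc r                 ∎)
... | inj₂ 1+r≡n = begin
  n * (suc m / n)       ≡⟨ cong (n *_) (/-congˡ 1+m≡[1+q]*n) ⟩
  n * (suc q * n / n)   ≡⟨ cong (n *_) (m*n/n≡m (suc q) n) ⟩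
  n * suc q             ≡⟨ *-suc n q ⟩
  n + n * q             ≡⟨ +-comm n (n * q) ⟩
  n * q + n             ≡⟨ cong (λ b → n * q + (if b then n else 0))
                               (dec-true (n ∣? suc m) (divides (suc q) 1+m≡[1+q]*n)) ⟨
  n * q + (if does (n ∣? suc m) then n else 0) ∎
  where
  q = m / n
  1+m≡[1+q]*n : suc m ≡ suc q * n
  1+m≡[1+q]*n = trans (cong suc (m≡m%n+[m/n]*n m n)) (cong (_+ q * n) 1+r≡n)

[m+n]%d≡n%d⇔d∣m : ∀ m n d .{{_ : NonZero d}} → (m + n) % d ≡ n % d ⇔ d ∣ m
[m+n]%d≡n%d⇔d∣m m n d = mk⇔ to (λ d∣m → %-remove-+ˡ n d∣m)
  where
  to : (m + n) % d ≡ n % d → d ∣ m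
  to eq = divides ((m + n) / d ∸ n / d) (begin
    m                                 ≡⟨ m+n∸n≡m m (n / d * d) ⟨
    m + n / d * d ∸ n / d * d         ≡⟨ cong (_∸ n / d * d) (+-cancelˡ-≡ (n % d) _ _ shifted) ⟩
    (m + n) / d * d ∸ n / d * d       ≡⟨ *-distribʳ-∸ d ((m + n) / d) (n / d) ⟨
    ((m + n) / d ∸ n / d) * d         ∎)
    where
    shifted : n % d + (m + n / d * d) ≡ n % d + (m + n) / d * d
    shifted = begin
      n % d + (m + n / d * d)         ≡⟨ x∙yz≈y∙xz (n % d) m (n / d * d) ⟩
      m + (n % d + n / d * d)         ≡⟨ cong (m +_) (m≡m%n+[m/n]*n n d) ⟨
      m + n                           ≡⟨ m≡m%n+[m/n]*n (m + n) d ⟩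
      (m + n) % d + (m + n) / d * d   ≡⟨ cong (_+ (m + n) / d * d) eq ⟩
      n % d + (m + n) / d * d         ∎

x<2^k⇒bit[k,x]≡0 : ∀ k {x} → x < 2 ^ k → bit k x ≡ 0
x<2^k⇒bit[k,x]≡0 k x<2^k = cong (_% 2) (m<n⇒m/n≡0 {{m^n≢0 2 k}} x<2^k)

k<i⇒bit[k,2^i+x]≡bit[k,x] : ∀ {k i} x → k < i → bit k (2 ^ i + x) ≡ bit k x
k<i⇒bit[k,2^i+x]≡bit[k,x] {k} {i} x k<i = begin
  bit k (2 ^ i + x)               ≡⟨ cong (bit k) 2^i+x≡x+c*2^k ⟩
  div2^ (x + c * 2 ^ k) k % 2     ≡⟨ cong (_% 2) ([m+k*n]/n≡m/n+k x c (2 ^ k)) ⟩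
  (div2^ x k + c) % 2             ≡⟨ %-remove-+ʳ (div2^ x k) 2∣c ⟩
  bit k x                         ∎
  where
  instance _ = m^n≢0 2 k
  c = 2 ^ (i ∸ k)
  2∣c : 2 ∣ c
  2∣c = subst (λ e → 2 ∣ 2 ^ e) (sym (+-∸-assoc 1 k<i)) (m∣m*n (2 ^ (i ∸ suc k)))
  2^i+x≡x+c*2^k : 2 ^ i + x ≡ x + c * 2 ^ k
  2^i+x≡x+c*2^k = begin
    2 ^ i + x                     ≡⟨ +-comm (2 ^ i) x ⟩
    x + 2 ^ i                     ≡⟨ cong (λ e → x + 2 ^ e) (m∸n+n≡m (<⇒≤ k<i)) ⟨
    x + 2 ^ (i ∸ k + k)           ≡⟨ cong (x +_) (^-distribˡ-+-* 2 (i ∸ k) k) ⟩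
    x + c * 2 ^ k                 ∎

x<2^i⇒bit[i,2^i+x]≡1 : ∀ i {x} → x < 2 ^ i → bit i (2 ^ i + x) ≡ 1
x<2^i⇒bit[i,2^i+x]≡1 i {x} x<2^i = begin
  bit i (2 ^ i + x)               ≡⟨ cong (bit i) (trans (+-comm (2 ^ i) x) (cong (x +_) (sym (*-identityˡ (2 ^ i))))) ⟩
  div2^ (x + 1 * 2 ^ i) i % 2     ≡⟨ cong (_% 2) ([m+k*n]/n≡m/n+k x 1 (2 ^ i)) ⟩
  (div2^ x i + 1) % 2             ≡⟨ cong (λ q → (q + 1) % 2) (m<n⇒m/n≡0 x<2^i) ⟩
  1                               ∎
  where instance _ = m^n≢0 2 i

2^k*div2^≡bit+2^[1+k]*div2^ : ∀ x k →
  2 ^ k * div2^ x k ≡ bit k x * 2 ^ k + 2 ^ suc k * div2^ x (suc k)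
2^k*div2^≡bit+2^[1+k]*div2^ x k = begin
  2 ^ k * q                            ≡⟨ cong (2 ^ k *_) (m≡m%n+[m/n]*n q 2) ⟩
  2 ^ k * (q % 2 + q / 2 * 2)          ≡⟨ solve 3 (λ p b h → p :* (b :+ h :* con 2) := b :* p :+ (con 2 :* p) :* h)
                                             refl (2 ^ k) (q % 2) (q / 2) ⟩
  q % 2 * 2 ^ k + 2 ^ suc k * (q / 2)  ≡⟨ cong (λ h → q % 2 * 2 ^ k + 2 ^ suc k * h) q/2≡div2^[x,1+k] ⟩
  bit k x * 2 ^ k + 2 ^ suc k * div2^ x (suc k) ∎
  where
  open +-*-Solver
  instance
    _ = m^n≢0 2 k
    _ = m^n≢0 2 (suc k)
    _ = m*n≢0 (2 ^ k) 2
  q = div2^ x k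
  q/2≡div2^[x,1+k] : q / 2 ≡ div2^ x (suc k)
  q/2≡div2^[x,1+k] = trans (m/n/o≡m/[n*o] x (2 ^ k) 2) (/-congʳ (*-comm (2 ^ k) 2))

n<2^n : ∀ n → n < 2 ^ n
n<2^n zero    = s≤s z≤n
n<2^n (suc n) = +-mono-≤ (m^n>0 2 n) (≤-trans (n<2^n n) (m≤m+n (2 ^ n) 0))

⌊log₂n⌋≤n : ∀ n → ⌊log₂ n ⌋ ≤ n
⌊log₂n⌋≤n n = subst (⌊log₂ n ⌋ ≤_) (⌊log₂[2^n]⌋≡n n) (⌊log₂⌋-mono-≤ (<⇒≤ (n<2^n n)))

n<2^[1+⌊log₂n⌋] : ∀ n → n < 2 ^ suc ⌊log₂ n ⌋
n<2^[1+⌊log₂n⌋] n with 2 ^ suc ⌊log₂ n ⌋ ≤? n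
... | no  2^[1+L]≰n = ≰⇒> 2^[1+L]≰n
... | yes 2^[1+L]≤n = contradiction
  (subst (_≤ ⌊log₂ n ⌋) (⌊log₂[2^n]⌋≡n (suc ⌊log₂ n ⌋)) (⌊log₂⌋-mono-≤ 2^[1+L]≤n)) 1+n≰n

dTerm : ℕ → ℕ → ℕ
dTerm n k = bit k (n ∸ k) * 2 ^ k

n<k+2^k⇒dTerm≡0 : ∀ {n k} → n < k + 2 ^ k → dTerm n k ≡ 0
n<k+2^k⇒dTerm≡0 {n} {k} n<k+2^k =
  cong (_* 2 ^ k) (x<2^k⇒bit[k,x]≡0 k (m<n+o⇒m∸n<o n k {{m^n≢0 2 k}} n<k+2^k))

d-truncate : ∀ {m n} → m ≤ n → n < suc m + 2 ^ suc m → d n ≡ sumTo m (dTerm n)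
d-truncate {m} {n} m≤n n<1+m+2^[1+m] = sumTo-truncate (dTerm n) m≤n (λ {k} m<k →
  n<k+2^k⇒dTerm≡0 {n} {k} (<-≤-trans n<1+m+2^[1+m] (+-mono-≤ m<k (^-monoʳ-≤ 2 m<k))))

d≡sumTo⌊log₂n⌋ : ∀ n → d n ≡ sumTo ⌊log₂ n ⌋ (dTerm n)
d≡sumTo⌊log₂n⌋ n = d-truncate (⌊log₂n⌋≤n n)
  (<-≤-trans (n<2^[1+⌊log₂n⌋] n) (m≤n+m (2 ^ suc ⌊log₂ n ⌋) (suc ⌊log₂ n ⌋)))

dTerm-2^+ : ∀ {k i} n → k < i → k ≤ n → dTerm (2 ^ i + n) k ≡ dTerm n k
dTerm-2^+ {k} {i} n k<i k≤n = cong (_* 2 ^ k) (begin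
  bit k (2 ^ i + n ∸ k)     ≡⟨ cong (bit k) (+-∸-assoc (2 ^ i) k≤n) ⟩
  bit k (2 ^ i + (n ∸ k))   ≡⟨ k<i⇒bit[k,2^i+x]≡bit[k,x] (n ∸ k) k<i ⟩
  bit k (n ∸ k)             ∎)

highPart : ℕ → ℕ → ℕ
highPart n k = 2 ^ suc k * div2^ (n ∸ k) (suc k)

condTerm : ℕ → ℕ → ℕ
condTerm n k = if does (mod2^ n k ≟ mod2^ (k ∸ 1) k) then 2 ^ k else 0

highPart-step : ∀ {n k} → k < n →
  highPart n k ≡ dTerm n (suc k) + highPart n (suc k) + condTerm n (suc k)
highPart-step {n} {k} k<n = begin
  M * div2^ (n ∸ k) (suc k)                           ≡⟨ cong (λ x → M * div2^ x (suc k)) n∸k≡1+y ⟩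
  M * (suc y / M)                                     ≡⟨ *-/-suc y M ⟩
  M * (y / M) + (if does (M ∣? suc y) then M else 0)  ≡⟨ cong₂ (λ h b → h + (if b then M else 0))
                                                           (2^k*div2^≡bit+2^[1+k]*div2^ y (suc k)) (sym condTerm-∣) ⟩
  dTerm n (suc k) + highPart n (suc k) + condTerm n (suc k) ∎
  where
  instance _ = m^n≢0 2 (suc k)
  M = 2 ^ suc k
  y = n ∸ suc k
  n∸k≡1+y : n ∸ k ≡ suc y
  n∸k≡1+y = +-∸-assoc 1 k<n
  1+y+k≡n : suc y + k ≡ n
  1+y+k≡n = trans (cong (_+ k) (sym n∸k≡1+y)) (m∸n+n≡m (<⇒≤ k<n))
  condTerm-∣ : does (n % M ≟ k % M) ≡ does (M ∣? suc y)
  condTerm-∣ = does-⇔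
    (subst (λ x → x % M ≡ k % M ⇔ M ∣ suc y) 1+y+k≡n ([m+n]%d≡n%d⇔d∣m (suc y) k M))
    (n % M ≟ k % M) (M ∣? suc y)

sumTo-dTerm+condSum+highPart≡n : ∀ {n} m → m ≤ n →
  sumTo m (dTerm n) + condSum n m + highPart n m ≡ n
sumTo-dTerm+condSum+highPart≡n {n} zero _ = begin
  dTerm n 0 + 0 + highPart n 0  ≡⟨ cong (_+ highPart n 0) (+-identityʳ (dTerm n 0)) ⟩
  dTerm n 0 + highPart n 0      ≡⟨ 2^k*div2^≡bit+2^[1+k]*div2^ n 0 ⟨
  1 * (n / 1)                   ≡⟨ *-identityˡ (n / 1) ⟩
  n / 1                         ≡⟨ n/1≡n n ⟩
  n                             ∎
sumTo-dTerm+condSum+highPart≡n {n} (suc m) m<n = begin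
  (S + t) + (C + c) + h         ≡⟨ solve 5 (λ S t C c h → S :+ t :+ (C :+ c) :+ h := S :+ C :+ (t :+ h :+ c))
                                     refl S t C c h ⟩
  S + C + (t + h + c)           ≡⟨ cong (S + C +_) (highPart-step m<n) ⟨
  S + C + highPart n m          ≡⟨ sumTo-dTerm+condSum+highPart≡n m (<⇒≤ m<n) ⟩
  n                             ∎
  where
  open +-*-Solver
  S = sumTo m (dTerm n)
  t = dTerm n (suc m)
  C = condSum n m
  c = condTerm n (suc m)
  h = highPart n (suc m)

highPart[n,⌊log₂n⌋]≡0 : ∀ n → highPart n ⌊log₂ n ⌋ ≡ 0
highPart[n,⌊log₂n⌋]≡0 n = trans (cong (2 ^ suc L *_) (m<n⇒m/n≡0 n∸L<2^[1+L])) (*-zeroʳ (2 ^ suc L))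
  where
  instance _ = m^n≢0 2 (suc ⌊log₂ n ⌋)
  L = ⌊log₂ n ⌋
  n∸L<2^[1+L] : n ∸ L < 2 ^ suc L
  n∸L<2^[1+L] = ≤-<-trans (m∸n≤m n L) (n<2^[1+⌊log₂n⌋] n)

d+condSum≡n : ∀ n → d n + condSum n ⌊log₂ n ⌋ ≡ n
d+condSum≡n n = begin
  d n + C                     ≡⟨ cong (_+ C) (d≡sumTo⌊log₂n⌋ n) ⟩
  S + C                       ≡⟨ +-identityʳ (S + C) ⟨
  S + C + 0                   ≡⟨ cong (S + C +_) (highPart[n,⌊log₂n⌋]≡0 n) ⟨
  S + C + highPart n L        ≡⟨ sumTo-dTerm+condSum+highPart≡n L (⌊log₂n⌋≤n n) ⟩
  n                           ∎
  where
  L = ⌊log₂ n ⌋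
  S = sumTo L (dTerm n)
  C = condSum n L

d≡n-condSum : ∀ n → ℤ.+ (d n) ≡ ℤ.+ n ℤ.- ℤ.+ (condSum n ⌊log₂ n ⌋)
d≡n-condSum n = sym (begin
  ℤ.+ n ℤ.- ℤ.+ C     ≡⟨ ℤP.m-n≡m⊖n n C ⟩
  n ℤ.⊖ C             ≡⟨ ℤP.⊖-≥ C≤n ⟩
  ℤ.+ (n ∸ C)         ≡⟨ cong (λ m → ℤ.+ (m ∸ C)) (d+condSum≡n n) ⟨
  ℤ.+ (d n + C ∸ C)   ≡⟨ cong ℤ.+_ (m+n∸n≡m (d n) C) ⟩
  ℤ.+ d n             ∎)
  where
  C = condSum n ⌊log₂ n ⌋
  C≤n : C ≤ n
  C≤n = subst (C ≤_) (d+condSum≡n n) (m≤n+m C (d n))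

d[2^i+i∸1]≡d[i∸1] : ∀ i → 1 ≤ i → d (2 ^ i + i ∸ 1) ≡ d (i ∸ 1)
d[2^i+i∸1]≡d[i∸1] (suc i) _ = begin
  d (P + suc i ∸ 1)           ≡⟨ cong d (+-∸-assoc P (s≤s z≤n)) ⟩
  d (P + i)                   ≡⟨ d-truncate (m≤n+m i P) P+i<1+i+P ⟩
  sumTo i (dTerm (P + i))     ≡⟨ sumTo-cong i (λ k≤i → dTerm-2^+ i (s≤s k≤i) k≤i) ⟩
  d i                         ∎
  where
  P = 2 ^ suc i
  P+i<1+i+P : P + i < suc i + P
  P+i<1+i+P = subst (P + i <_) (+-comm P (suc i)) (+-monoʳ-< P (n<1+n i))

d[2^i+i+j]≡2^i+d[i+j] : ∀ i j → 1 ≤ i → j ≤ 2 ^ i ∸ 1 → d (2 ^ i + i + j) ≡ 2 ^ i + d (i + j)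
d[2^i+i+j]≡2^i+d[i+j] (suc i) j _ j≤P∸1 = begin
  d (P + suc i + j)                              ≡⟨ cong d (+-assoc P (suc i) j) ⟩
  d (P + n)                                      ≡⟨ d-truncate (≤-trans (m≤m+n (suc i) j) (m≤n+m n P)) P+n<2+i+2P ⟩
  sumTo i (dTerm (P + n)) + dTerm (P + n) (suc i) ≡⟨ cong₂ _+_
                                                      (sumTo-cong i (λ k≤i → dTerm-2^+ n (s≤s k≤i) (≤-trans k≤i i≤n)))
                                                      top ⟩
  sumTo i (dTerm n) + P                          ≡⟨ +-comm _ P ⟩
  P + sumTo i (dTerm n)                          ≡⟨ cong (P +_) (d-truncate i≤n (+-monoʳ-< (suc i) j<P)) ⟨
  P + d n                                        ∎
  where
  P = 2 ^ suc i
  n = suc i + j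
  i≤n : i ≤ n
  i≤n = ≤-trans (n≤1+n i) (m≤m+n (suc i) j)
  j<P : j < P
  j<P = ≤-<-trans j≤P∸1 (∸-monoʳ-< (s≤s z≤n) (m^n>0 2 (suc i)))
  P+n<2+i+2P : P + n < suc (suc i) + 2 ^ suc (suc i)
  P+n<2+i+2P = s≤s (≤-trans (≤-reflexive (x∙yz≈y∙xz P (suc i) j))
                             (+-monoʳ-≤ (suc i) (+-monoʳ-≤ P (≤-trans (<⇒≤ j<P) (m≤m+n P 0)))))
  top : dTerm (P + n) (suc i) ≡ P
  top = begin
    bit (suc i) (P + n ∸ suc i) * P     ≡⟨ cong (λ x → bit (suc i) x * P) (+-∸-assoc P (m≤m+n (suc i) j)) ⟩
    bit (suc i) (P + (n ∸ suc i)) * P   ≡⟨ cong (λ x → bit (suc i) (P + x) * P) (m+n∸m≡n (suc i) j) ⟩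
    bit (suc i) (P + j) * P             ≡⟨ cong (_* P) (x<2^i⇒bit[i,2^i+x]≡1 (suc i) j<P) ⟩
    1 * P                               ≡⟨ *-identityˡ P ⟩
    P                                   ∎

-- ℕ→ℚ n unfolds to fromℚᵘ (mkℚᵘ (+ n) 0).
ℕ→ℚ-toℚᵘ : ∀ n → ℚ.toℚᵘ (ℕ→ℚ n) ℚᵘ.≃ ℚᵘ.mkℚᵘ (ℤ.+ n) 0
ℕ→ℚ-toℚᵘ n = ℚP.toℚᵘ-fromℚᵘ (ℚᵘ.mkℚᵘ (ℤ.+ n) 0)

ℕ→ℚ-+ : ∀ m n → ℕ→ℚ (m + n) ≡ ℕ→ℚ m ℚ.+ ℕ→ℚ n
ℕ→ℚ-+ m n = ℚP.toℚᵘ-injective (≃-trans (ℕ→ℚ-toℚᵘ (m + n)) (≃-trans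
  (ℚᵘ.*≡* (cong (ℤ._* ℤ.1ℤ) (trans (ℤP.pos-+ m n)
    (sym (cong₂ ℤ._+_ (ℤP.*-identityʳ (ℤ.+ m)) (ℤP.*-identityʳ (ℤ.+ n)))))))
  (≃-trans (ℚᵘP.+-cong (≃-sym (ℕ→ℚ-toℚᵘ m)) (≃-sym (ℕ→ℚ-toℚᵘ n)))
           (≃-sym (ℚP.toℚᵘ-homo-+ (ℕ→ℚ m) (ℕ→ℚ n))))))
  where open ℚᵘP using (≃-trans; ≃-sym)

ℕ→ℚ-* : ∀ m n → ℕ→ℚ (m * n) ≡ ℕ→ℚ m ℚ.* ℕ→ℚ n
ℕ→ℚ-* m n = ℚP.toℚᵘ-injective (≃-trans (ℕ→ℚ-toℚᵘ (m * n)) (≃-trans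
  (ℚᵘ.*≡* (cong (ℤ._* ℤ.1ℤ) (ℤP.pos-* m n)))
  (≃-trans (ℚᵘP.*-cong (≃-sym (ℕ→ℚ-toℚᵘ m)) (≃-sym (ℕ→ℚ-toℚᵘ n)))
           (≃-sym (ℚP.toℚᵘ-homo-* (ℕ→ℚ m) (ℕ→ℚ n))))))
  where open ℚᵘP using (≃-trans; ≃-sym)

powℚ[-1] : ∀ q → powℚ (ℚ.- ℚ.1ℚ) q ≡ ℚ.1ℚ ℚ.- ℕ→ℚ 2 ℚ.* ℕ→ℚ (q % 2)
powℚ[-1] zero          = refl
powℚ[-1] (suc zero)    = refl
powℚ[-1] (suc (suc q)) = begin
  -1ℚ ℚ.* (-1ℚ ℚ.* powℚ -1ℚ q)  ≡⟨ ℚP.*-assoc -1ℚ -1ℚ (powℚ -1ℚ q) ⟨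
  (-1ℚ ℚ.* -1ℚ) ℚ.* powℚ -1ℚ q  ≡⟨ ℚP.*-identityˡ (powℚ -1ℚ q) ⟩
  powℚ -1ℚ q                    ≡⟨ powℚ[-1] q ⟩
  ℚ.1ℚ ℚ.- ℕ→ℚ 2 ℚ.* ℕ→ℚ (q % 2) ∎
  where
  -1ℚ = ℚ.- ℚ.1ℚ

signed-2^ : ∀ q k →
  powℚ (ℚ.- ℚ.1ℚ) q ℚ.* ℕ→ℚ (2 ^ k) ≡ ℕ→ℚ (2 ^ k) ℚ.- ℕ→ℚ 2 ℚ.* ℕ→ℚ (q % 2 * 2 ^ k)
signed-2^ q k = begin
  powℚ (ℚ.- ℚ.1ℚ) q ℚ.* A             ≡⟨ cong (ℚ._* A) (powℚ[-1] q) ⟩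
  (ℚ.1ℚ ℚ.- ℕ→ℚ 2 ℚ.* b) ℚ.* A       ≡⟨ solve 2 (λ b A → (con ℚ.1ℚ :- con (ℕ→ℚ 2) :* b) :* A
                                                    := A :- con (ℕ→ℚ 2) :* (b :* A)) refl b A ⟩
  A ℚ.- ℕ→ℚ 2 ℚ.* (b ℚ.* A)           ≡⟨ cong (λ x → A ℚ.- ℕ→ℚ 2 ℚ.* x) (ℕ→ℚ-* (q % 2) (2 ^ k)) ⟨
  A ℚ.- ℕ→ℚ 2 ℚ.* ℕ→ℚ (q % 2 * 2 ^ k) ∎
  where
  open ℚSolver.+-*-Solver
  A = ℕ→ℚ (2 ^ k)
  b = ℕ→ℚ (q % 2)

sumToℚ-signed-2^ : ∀ (q : ℕ → ℕ) L →
  sumToℚ L (λ k → powℚ (ℚ.- ℚ.1ℚ) (q k) ℚ.* ℕ→ℚ (2 ^ k))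
    ≡ ℕ→ℚ 2 ℚ.* ℕ→ℚ (2 ^ L) ℚ.- ℚ.1ℚ ℚ.- ℕ→ℚ 2 ℚ.* ℕ→ℚ (sumTo L (λ k → q k % 2 * 2 ^ k))
-- Both 2 * 2 ^ 0 - 1 and 2 ^ 0 compute to 1ℚ.
sumToℚ-signed-2^ q zero = signed-2^ (q 0) 0
sumToℚ-signed-2^ q (suc L) = begin
  sumToℚ L f ℚ.+ f (suc L)
    ≡⟨ cong₂ ℚ._+_ (sumToℚ-signed-2^ q L) (signed-2^ (q (suc L)) (suc L)) ⟩
  (two ℚ.* A ℚ.- ℚ.1ℚ ℚ.- two ℚ.* ℕ→ℚ S) ℚ.+ (ℕ→ℚ (2 * 2 ^ L) ℚ.- two ℚ.* ℕ→ℚ T)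
    ≡⟨ cong (λ a → (two ℚ.* A ℚ.- ℚ.1ℚ ℚ.- two ℚ.* ℕ→ℚ S) ℚ.+ (a ℚ.- two ℚ.* ℕ→ℚ T)) (ℕ→ℚ-* 2 (2 ^ L)) ⟩
  (two ℚ.* A ℚ.- ℚ.1ℚ ℚ.- two ℚ.* ℕ→ℚ S) ℚ.+ (two ℚ.* A ℚ.- two ℚ.* ℕ→ℚ T)
    ≡⟨ solve 3 (λ A s t → (con two :* A :- con ℚ.1ℚ :- con two :* s) :+ (con two :* A :- con two :* t)
                        := con two :* (con two :* A) :- con ℚ.1ℚ :- con two :* (s :+ t))
             refl A (ℕ→ℚ S) (ℕ→ℚ T) ⟩
  two ℚ.* (two ℚ.* A) ℚ.- ℚ.1ℚ ℚ.- two ℚ.* (ℕ→ℚ S ℚ.+ ℕ→ℚ T)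
    ≡⟨ cong₂ (λ a s → two ℚ.* a ℚ.- ℚ.1ℚ ℚ.- two ℚ.* s) (ℕ→ℚ-* 2 (2 ^ L)) (ℕ→ℚ-+ S T) ⟨
  two ℚ.* ℕ→ℚ (2 * 2 ^ L) ℚ.- ℚ.1ℚ ℚ.- two ℚ.* ℕ→ℚ (S + T) ∎
  where
  open ℚSolver.+-*-Solver
  f = λ k → powℚ (ℚ.- ℚ.1ℚ) (q k) ℚ.* ℕ→ℚ (2 ^ k)
  two = ℕ→ℚ 2
  A = ℕ→ℚ (2 ^ L)
  S = sumTo L (λ k → q k % 2 * 2 ^ k)
  T = q (suc L) % 2 * 2 ^ suc L

ℕ→ℚ-d : ∀ n → ℕ→ℚ (d n) ≡
  (ℕ→ℚ (2 ^ ⌊log₂ n ⌋) ℚ.- ℚ.½)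
    ℚ.- ℚ.½ ℚ.* sumToℚ ⌊log₂ n ⌋ (λ k → powℚ (ℚ.- ℚ.1ℚ) (div2^ (n ∸ k) k) ℚ.* ℕ→ℚ (2 ^ k))
ℕ→ℚ-d n = begin
  ℕ→ℚ (d n)             ≡⟨ cong ℕ→ℚ (d≡sumTo⌊log₂n⌋ n) ⟩
  ℕ→ℚ S                 ≡⟨ solve 2 (λ A s → s := (A :- con ℚ.½)
                                                    :- con ℚ.½ :* (con two :* A :- con ℚ.1ℚ :- con two :* s))
                              refl A (ℕ→ℚ S) ⟩
  (A ℚ.- ℚ.½) ℚ.- ℚ.½ ℚ.* (two ℚ.* A ℚ.- ℚ.1ℚ ℚ.- two ℚ.* ℕ→ℚ S)
                        ≡⟨ cong (λ x → (A ℚ.- ℚ.½) ℚ.- ℚ.½ ℚ.* x)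
                                (sumToℚ-signed-2^ (λ k → div2^ (n ∸ k) k) L) ⟨
  (A ℚ.- ℚ.½) ℚ.- ℚ.½ ℚ.* sumToℚ L (λ k → powℚ (ℚ.- ℚ.1ℚ) (div2^ (n ∸ k) k) ℚ.* ℕ→ℚ (2 ^ k)) ∎
  where
  open ℚSolver.+-*-Solver
  L = ⌊log₂ n ⌋
  two = ℕ→ℚ 2
  A = ℕ→ℚ (2 ^ L)
  S = sumTo L (dTerm n)

theorem2 :
    (∀ (n : ℕ) → 0 < n →
      ℕ→ℚ (d n) ≡
        ((ℕ→ℚ (2 ^ ⌊log₂ n ⌋) ℚ.- ℚ.½)
          ℚ.- (ℚ.½ ℚ.* sumToℚ ⌊log₂ n ⌋
                 (λ k → powℚ (ℚ.- ℚ.1ℚ) (div2^ (n ∸ k) k) ℚ.* ℕ→ℚ (2 ^ k)))))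
    × ((d 0 ≡ 0) × (d 1 ≡ 1)
       × (∀ (i : ℕ) → 1 ≤ i → d (2 ^ i + i ∸ 1) ≡ d (i ∸ 1))
       × (∀ (i j : ℕ) → 1 ≤ i → j ≤ 2 ^ i ∸ 1 → d (2 ^ i + i + j) ≡ 2 ^ i + d (i + j)))
    × (∀ (n : ℕ) → 1 ≤ n →
        ℤ.+ (d n) ≡ ℤ.+ n ℤ.- ℤ.+ (condSum n ⌊log₂ n ⌋))
-- The identities (i) and (iii) also hold for n = 0.
theorem2 =
    (λ n _ → ℕ→ℚ-d n)
  , (refl , refl , d[2^i+i∸1]≡d[i∸1] , d[2^i+i+j]≡2^i+d[i+j])
  , (λ n _ → d≡n-condSum n)
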